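{- The classes of split graphs, threshold graphs, and weakly threshold graphs are each closed under complementation. More generally, for any set $I$ of nonnegative integers, the classes $\mathcal{A}_I=\{G: G \text{ is a simple graph whose degree sequence } d \text{ satisfies } \Delta_{m(d)}(d)\in I\}$ and $\mathcal{B}_I=\{G: G \text{ is a simple graph whose degree sequence } d \text{ satisfies } \Delta^*(d)\in I\}$ are closed under complementation (the complement of any graph in the class is in the class).
   Context: For a finite simple graph with degree sequence $d=(d_1,\dots,d_n)$ in nonincreasing order: $m(d)=\max\{i:d_i\ge i-1\}$; $\Delta_k(d)=k(k-1)+\sum_{i>k}\min\{k,d_i\}-\sum_{i\le k}d_i$; $\Delta^*(d)=\max\{\Delta_k(d):1\le k\le m(d)\}$. A split graph is a graph whose vertex set can be partitioned into a clique and an independent set. A threshold graph is a graph admitting real vertex weights and a real threshold such that two distinct vertices are adjacent exactly when the sum of their weights is at least the threshold. A weakly threshold graph is a graph whose degree sequence $d$ satisfies $\Delta_k(d)\le 1$ for all $k\in\{1,\dots,m(d)\}$.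
   Formalization: The vertex weights and the threshold of a threshold graph are rational rather than real. -}

module Defs where

open import Data.Bool using (Bool; true; false; if_then_else_; not)
open import Data.Nat as ℕ using (ℕ; zero; suc; _∸_; _≤ᵇ_)
open import Data.Fin using (Fin; _≟_)
open import Data.List using (List; []; _∷_; map; take; drop; foldr; allFin)
open import Data.Nat.ListAction using (sum)
open import Data.Integer as ℤ using (ℤ; +_; _-_; _⊔_)
open import Data.Rational as ℚ using (ℚ)
open import Data.Product using (Σ; _×_; _,_)
open import Relation.Binary.PropositionalEquality using (_≡_; _≢_)
open import Relation.Nullary using (¬_; yes; no)
open import Function.Bundles using (_⇔_)

record Graph (n : ℕ) : Set where
  field
    adj    : Fin n → Fin n → Bool
    sym    : ∀ i j → adj i j ≡ adj j i
    irrefl : ∀ i → adj i i ≡ false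
open Graph public

Adj : ∀ {n} → Graph n → Fin n → Fin n → Set
Adj G i j = adj G i j ≡ true

private
  compAdj : ∀ {n} → Graph n → Fin n → Fin n → Bool
  compAdj G i j with i ≟ j
  ... | yes _ = false
  ... | no  _ = not (adj G i j)

  compSym : ∀ {n} (G : Graph n) i j → compAdj G i j ≡ compAdj G j i
  compSym G i j with i ≟ j | j ≟ i
  ... | yes _ | yes _ = _≡_.refl
  ... | yes p | no ¬q = Data.Empty.⊥-elim (¬q (Relation.Binary.PropositionalEquality.sym p))
    where import Data.Empty
  ... | no ¬p | yes q = Data.Empty.⊥-elim (¬p (Relation.Binary.PropositionalEquality.sym q))
    where import Data.Empty
  ... | no _  | no _ rewrite sym G i j = _≡_.refl

  compIrr : ∀ {n} (G : Graph n) i → compAdj G i i ≡ false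
  compIrr G i with i ≟ i
  ... | yes _ = _≡_.refl
  ... | no ¬p = Data.Empty.⊥-elim (¬p _≡_.refl)
    where import Data.Empty

complement : ∀ {n} → Graph n → Graph n
complement G = record { adj = compAdj G ; sym = compSym G ; irrefl = compIrr G }

degree : ∀ {n} → Graph n → Fin n → ℕ
degree {n} G i = sum (map (λ j → if adj G i j then 1 else 0) (allFin n))

insertDesc : ℕ → List ℕ → List ℕ
insertDesc x [] = x ∷ []
insertDesc x (y ∷ ys) = if y ≤ᵇ x then x ∷ y ∷ ys else y ∷ insertDesc x ys

sortDesc : List ℕ → List ℕ
sortDesc = foldr insertDesc []

degSeq : ∀ {n} → Graph n → List ℕ
degSeq {n} G = sortDesc (map (degree G) (allFin n))

-- m(d) = max { i : d_i ≥ i - 1 }   (positions are 1-indexed;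
-- convention m([]) = 0 for the empty sequence)

private
  mGo : ℕ → List ℕ → ℕ → ℕ
  mGo i [] acc = acc
  mGo i (x ∷ xs) acc = mGo (suc i) xs (if (i ∸ 1) ≤ᵇ x then i else acc)

m : List ℕ → ℕ
m d = mGo 1 d 0

Δ : ℕ → List ℕ → ℤ
Δ k d = + (k ℕ.* (k ∸ 1) ℕ.+ sum (map (ℕ._⊓ k) (drop k d))) - + sum (take k d)

oneTo : ℕ → List ℕ
oneTo zero = []
oneTo (suc k) = oneTo k Data.List.++ (suc k ∷ [])
  where import Data.List

-- Δ*(d) = max { Δ_k(d) : 1 ≤ k ≤ m(d) }
-- (only meaningful when m(d) ≥ 1, i.e. d nonempty; for the empty
--  sequence the value is the arbitrary convention Δ_1([]) = 0)
Δ* : List ℕ → ℤ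
Δ* d = foldr (λ k acc → Δ k d ⊔ acc) (Δ 1 d) (oneTo (m d))

IsSplit : ∀ {n} → Graph n → Set
IsSplit {n} G = Σ (Fin n → Bool) λ inC →
    (∀ i j → i ≢ j → inC i ≡ true → inC j ≡ true → Adj G i j)
  × (∀ i j → inC i ≡ false → inC j ≡ false → ¬ Adj G i j)

-- threshold: weights w and threshold t with
-- i ~ j  iff  w i + w j ≥ t, for distinct i, j
-- (weights are rational, not real)
IsThreshold : ∀ {n} → Graph n → Set
IsThreshold {n} G = Σ (Fin n → ℚ) λ w → Σ ℚ λ t →
  ∀ i j → i ≢ j → (Adj G i j ⇔ t ℚ.≤ w i ℚ.+ w j)

IsWeaklyThreshold : ∀ {n} → Graph n → Set
IsWeaklyThreshold G =
  ∀ k → 1 ℕ.≤ k → k ℕ.≤ m (degSeq G) → Δ k (degSeq G) ℤ.≤ + 1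

_∈ℕ_ : ℤ → (ℕ → Set) → Set
z ∈ℕ I = Σ ℕ λ k → (z ≡ + k) × I k

InA : (ℕ → Set) → ∀ {n} → Graph n → Set
InA I G = Δ (m (degSeq G)) (degSeq G) ∈ℕ I

InB : (ℕ → Set) → ∀ {n} → Graph n → Set
InB I G = Δ* (degSeq G) ∈ℕ I

-- If G has n vertices and degree sequence d, its complement has degree sequence
-- d̄ = (n−1−d_n, …, n−1−d_1). Split graphs complement by swapping clique and independent
-- set, threshold graphs by negating the weights and lowering the threshold.
-- For the classes defined through Δ, replace Δ_k by
--   Δ′_k(d) = Σ_{i>k} min(d_i, k) − Σ_{i≤k} (d_i + 1 − k)⁺,
-- which equals Δ_k(d) whenever k ≤ m(d) and satisfies Δ′_k(d̄) = Δ′_{n−k}(d). For l > m(d),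
-- Δ′_l(d) ≤ Δ′_k(d) with k = d_{l+1} < m(d); and n − m(d̄) is a point at which Δ′(d) takes
-- the value Δ′_{m(d)}(d). Hence every bound X ≥ 0 on Δ_1, …, Δ_m, the value Δ_m, and Δ*
-- (which is ≥ Δ_1 ≥ 0 for degree sequences) pass from d to d̄, and back since d̄̄ = d.

{-# OPTIONS --safe #-}
module Submission where

open import Defs hiding (sym)
open import Data.Bool using (Bool; true; false; if_then_else_; not)
open import Data.Bool.Properties using (not-injective; ¬-not)
open import Data.Nat using (ℕ; zero; suc; _+_; _*_; _∸_; _⊓_; _≤_; _<_; z≤n; s≤s; s≤s⁻¹; _≤ᵇ_)
open import Data.Nat.Properties
open import Data.Nat.ListAction using (sum)
open import Data.Nat.ListAction.Properties using (sum-++; sum-↭)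
open import Data.Nat.Tactic.RingSolver using (solve-∀)
open import Data.List
  using (List; []; _∷_; _++_; map; take; drop; length; reverse; foldr; tabulate; allFin; filter; cartesianProductWith)
open import Data.List.Properties
  using (map-++; map-∘; map-cong; map-cong-local; map-id; map-tabulate; length-map; length-take; length-drop;
         length-tabulate; take++drop≡id; take-[]; take-take; drop-drop; reverse-++; reverse-map; reverse-involutive)
open import Data.List.Relation.Unary.All as All using (All; []; _∷_)
import Data.List.Relation.Unary.All.Properties as All
open import Data.List.Relation.Unary.AllPairs as AllPairs using (AllPairs; []; _∷_)
import Data.List.Relation.Unary.AllPairs.Properties as AllPairs
open import Data.List.Relation.Binary.Permutation.Propositional
  using (_↭_; prep; swap; ↭-refl; ↭-sym; ↭-trans; ↭⇒↭ₛ; module PermutationReasoning)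
import Data.List.Relation.Binary.Permutation.Propositional.Properties as ↭
open import Data.List.Relation.Binary.Pointwise using (Pointwise-≡⇒≡)
import Data.List.Relation.Unary.Sorted.TotalOrder.Properties as Sorted
import Relation.Binary.Construct.Flip.EqAndOrd as Flip
open import Data.Integer as ℤ using (ℤ; _⊖_)
import Data.Integer.Properties as ℤ
open import Data.Rational as ℚ using (ℚ)
import Data.Rational.Properties as ℚ
open import Relation.Binary.Bundles using (DecTotalOrder)
open import Data.List.Extrema (DecTotalOrder.totalOrder ℚ.≤-decTotalOrder) using (max; xs≤max; argmax-all)
open import Data.Product using (∃; _×_; _,_; proj₁; proj₂)
open import Data.Sum using (inj₁; inj₂)
open import Data.List.Relation.Unary.Any using (here)
open import Data.List.Membership.Propositional using (_∈_)
open import Data.List.Membership.Propositional.Properties using (∈-map⁻; ∈-filter⁺; ∈-allFin; ∈-cartesianProductWith⁺)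
open import Data.Empty using (⊥-elim)
open import Relation.Nullary using (¬_; Dec; yes; no; does)
open import Data.Fin as Fin using (Fin)
open import Relation.Binary.Definitions using (tri<; tri≈; tri>)
open import Relation.Nullary.Reflects using (ofʸ; ofⁿ)
open import Relation.Binary.PropositionalEquality
open import Function.Bundles using (mk⇔; Equivalence)
open import Function.Base using (_∘_; case_of_)

+-cancelʳ-⊖ : ∀ a b e → (a + e) ⊖ (b + e) ≡ a ⊖ b
+-cancelʳ-⊖ a b e = trans (cong₂ _⊖_ (+-comm a e) (+-comm b e)) (ℤ.+-cancelˡ-⊖ e a b)

diff-≤-cross : ∀ a b c e → a + e ≤ c + b → ℤ.+ a ℤ.- ℤ.+ b ℤ.≤ ℤ.+ c ℤ.- ℤ.+ e
diff-≤-cross a b c e a+e≤c+b = begin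
  ℤ.+ a ℤ.- ℤ.+ b   ≡⟨ ℤ.m-n≡m⊖n a b ⟩
  a ⊖ b             ≡⟨ +-cancelʳ-⊖ a b e ⟨
  (a + e) ⊖ (b + e) ≤⟨ ℤ.⊖-monoˡ-≤ (b + e) a+e≤c+b ⟩
  (c + b) ⊖ (b + e) ≡⟨ cong (_⊖ (b + e)) (+-comm c b) ⟩
  (b + c) ⊖ (b + e) ≡⟨ ℤ.+-cancelˡ-⊖ b c e ⟩
  c ⊖ e             ≡⟨ ℤ.m-n≡m⊖n c e ⟨
  ℤ.+ c ℤ.- ℤ.+ e   ∎
  where open ℤ.≤-Reasoning

diff-≡-cross : ∀ a b c e → a + e ≡ c + b → ℤ.+ a ℤ.- ℤ.+ b ≡ ℤ.+ c ℤ.- ℤ.+ e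
diff-≡-cross a b c e a+e≡c+b =
  ℤ.≤-antisym (diff-≤-cross a b c e (≤-reflexive a+e≡c+b)) (diff-≤-cross c e a b (≤-reflexive (sym a+e≡c+b)))

[m+n∸o]⊓n+[o∸m]≡n : ∀ m n o → o ≤ m + n → (m + n ∸ o) ⊓ n + (o ∸ m) ≡ n
[m+n∸o]⊓n+[o∸m]≡n m n o o≤m+n with ≤-total o m
... | inj₁ o≤m = begin
  (m + n ∸ o) ⊓ n + (o ∸ m) ≡⟨ cong₂ _+_ (m≥n⇒m⊓n≡n n≤m+n∸o) (m≤n⇒m∸n≡0 o≤m) ⟩
  n + 0                     ≡⟨ +-identityʳ n ⟩
  n                         ∎
  where
  open ≡-Reasoning
  n≤m+n∸o : n ≤ m + n ∸ o
  n≤m+n∸o = ≤-trans (≤-reflexive (sym (m+n∸m≡n m n))) (∸-monoʳ-≤ (m + n) o≤m)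
... | inj₂ m≤o with m≤n⇒∃[o]m+o≡n m≤o
...   | t , refl = begin
  (m + n ∸ (m + t)) ⊓ n + (m + t ∸ m) ≡⟨ cong₂ (λ u v → u ⊓ n + v) ([m+n]∸[m+o]≡n∸o m n t) (m+n∸m≡n m t) ⟩
  (n ∸ t) ⊓ n + t                     ≡⟨ cong (_+ t) (m≤n⇒m⊓n≡m (m∸n≤m n t)) ⟩
  n ∸ t + t                           ≡⟨ m∸n+n≡m (+-cancelˡ-≤ m t n o≤m+n) ⟩
  n                                   ∎
  where open ≡-Reasoning

o⊓m+[m+n∸o∸n]≡m : ∀ m n o → o ≤ m + n → o ⊓ m + (m + n ∸ o ∸ n) ≡ m
o⊓m+[m+n∸o∸n]≡m m n o o≤m+n with ≤-total o m
... | inj₁ o≤m = begin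
  o ⊓ m + (m + n ∸ o ∸ n)   ≡⟨ cong₂ _+_ (m≤n⇒m⊓n≡m o≤m) (cong (_∸ n) (+-∸-comm n o≤m)) ⟩
  o + (m ∸ o + n ∸ n)       ≡⟨ cong (o +_) (m+n∸n≡m (m ∸ o) n) ⟩
  o + (m ∸ o)               ≡⟨ m+[n∸m]≡n o≤m ⟩
  m                         ∎
  where open ≡-Reasoning
... | inj₂ m≤o = begin
  o ⊓ m + (m + n ∸ o ∸ n)   ≡⟨ cong₂ _+_ (m≥n⇒m⊓n≡n m≤o) (m≤n⇒m∸n≡0 m+n∸o≤n) ⟩
  m + 0                     ≡⟨ +-identityʳ m ⟩
  m                         ∎
  where
  open ≡-Reasoning
  m+n∸o≤n : m + n ∸ o ≤ n
  m+n∸o≤n = ≤-trans (∸-monoʳ-≤ (m + n) m≤o) (≤-reflexive (m+n∸m≡n m n))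

≤-complement : ∀ n r x → x ≤ n ∸ 1 → r ≤ suc ((n ∸ 1) ∸ x) → x ≤ n ∸ r
≤-complement zero r zero _ _ = z≤n
≤-complement (suc n) r x x≤n r≤ = ≤-trans (≤-reflexive (sym (m+n∸m≡n r x))) (∸-monoˡ-≤ r (begin
  r + x               ≤⟨ +-monoˡ-≤ x r≤ ⟩
  suc (n ∸ x) + x     ≡⟨ cong suc (m∸n+n≡m x≤n) ⟩
  suc n               ∎))
  where open ≤-Reasoning

complement-≤ : ∀ n r x → x ≤ n ∸ 1 → suc ((n ∸ 1) ∸ x) ≤ r → n ∸ r ≤ x
complement-≤ zero r x _ _ = ≤-trans (≤-reflexive (0∸n≡0 r)) z≤n
complement-≤ (suc n) r x x≤n ≤r = ≤-trans (∸-monoˡ-≤ r (begin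
  suc n               ≡⟨ cong suc (m∸n+n≡m x≤n) ⟨
  suc (n ∸ x) + x     ≤⟨ +-monoˡ-≤ x ≤r ⟩
  r + x               ∎)) (≤-reflexive (m+n∸m≡n r x))
  where open ≤-Reasoning

-- Sums

∑ : {A : Set} → (A → ℕ) → List A → ℕ
∑ g xs = sum (map g xs)

module _ {A : Set} where

  ∑-++ : ∀ (g : A → ℕ) xs ys → ∑ g (xs ++ ys) ≡ ∑ g xs + ∑ g ys
  ∑-++ g xs ys = trans (cong sum (map-++ g xs ys)) (sum-++ (map g xs) (map g ys))

  ∑-+ : ∀ (g h : A → ℕ) xs → ∑ (λ x → g x + h x) xs ≡ ∑ g xs + ∑ h xs
  ∑-+ g h [] = refl
  ∑-+ g h (x ∷ xs) = trans (cong (g x + h x +_) (∑-+ g h xs)) (interchange (g x) (h x) (∑ g xs) (∑ h xs))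
    where
    interchange : ∀ a b c e → a + b + (c + e) ≡ a + c + (b + e)
    interchange = solve-∀

  ∑-cong : ∀ {g h : A → ℕ} {xs} → All (λ x → g x ≡ h x) xs → ∑ g xs ≡ ∑ h xs
  ∑-cong [] = refl
  ∑-cong (p ∷ ps) = cong₂ _+_ p (∑-cong ps)

  ∑-mono-≤ : ∀ {g h : A → ℕ} {xs} → All (λ x → g x ≤ h x) xs → ∑ g xs ≤ ∑ h xs
  ∑-mono-≤ [] = z≤n
  ∑-mono-≤ (p ∷ ps) = +-mono-≤ p (∑-mono-≤ ps)

  ∑-const : ∀ {g : A → ℕ} {c xs} → All (λ x → g x ≡ c) xs → ∑ g xs ≡ length xs * c
  ∑-const [] = refl
  ∑-const (p ∷ ps) = cong₂ _+_ p (∑-const ps)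

  ∑-constant : ∀ c xs → ∑ {A} (λ _ → c) xs ≡ length xs * c
  ∑-constant c xs = ∑-const (All.universal (λ _ → refl) xs)

  ∑-zero : ∀ {g : A → ℕ} {xs} → All (λ x → g x ≡ 0) xs → ∑ g xs ≡ 0
  ∑-zero {xs = xs} ps = trans (∑-const ps) (*-zeroʳ (length xs))

  ∑-↭ : ∀ (g : A → ℕ) {xs ys} → xs ↭ ys → ∑ g xs ≡ ∑ g ys
  ∑-↭ g p = sum-↭ (↭.map⁺ g p)

∑-∸-const : ∀ c {xs} → All (c ≤_) xs → length xs * c + ∑ (_∸ c) xs ≡ sum xs
∑-∸-const c [] = refl
∑-∸-const c {x ∷ xs} (c≤x ∷ ps) = begin
  (c + length xs * c) + ((x ∸ c) + ∑ (_∸ c) xs) ≡⟨ interchange c (length xs * c) (x ∸ c) (∑ (_∸ c) xs) ⟩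
  (c + (x ∸ c)) + (length xs * c + ∑ (_∸ c) xs) ≡⟨ cong₂ _+_ (m+[n∸m]≡n c≤x) (∑-∸-const c ps) ⟩
  x + sum xs                                    ∎
  where
  open ≡-Reasoning
  interchange : ∀ a b e f → a + b + (e + f) ≡ a + e + (b + f)
  interchange = solve-∀

length-take-≤ : ∀ {A : Set} k (xs : List A) → k ≤ length xs → length (take k xs) ≡ k
length-take-≤ k xs k≤ = trans (length-take k xs) (m≤n⇒m⊓n≡m k≤)

take-+ : ∀ {A : Set} k l (xs : List A) → take (k + l) xs ≡ take k xs ++ take l (drop k xs)
take-+ zero l xs = refl
take-+ (suc k) l [] = sym (take-[] l)
take-+ (suc k) l (x ∷ xs) = cong (x ∷_) (take-+ k l xs)

drop≡take++drop-+ : ∀ {A : Set} k l (xs : List A) → drop k xs ≡ take l (drop k xs) ++ drop (k + l) xs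
drop≡take++drop-+ k l xs = trans (sym (take++drop≡id l (drop k xs))) (cong (take l (drop k xs) ++_) (drop-drop k l xs))

take-length-++ : ∀ {A : Set} {k} (xs ys : List A) → length xs ≡ k → take k (xs ++ ys) ≡ xs
take-length-++ [] ys refl = refl
take-length-++ (x ∷ xs) ys refl = cong (x ∷_) (take-length-++ xs ys refl)

drop-length-++ : ∀ {A : Set} {k} (xs ys : List A) → length xs ≡ k → drop k (xs ++ ys) ≡ ys
drop-length-++ [] ys refl = refl
drop-length-++ (x ∷ xs) ys refl = drop-length-++ xs ys refl

All-take-≤ : ∀ {P : ℕ → Set} {k r} d → k ≤ r → All P (take r d) → All P (take k d)
All-take-≤ {k = k} {r} d k≤r h =
  subst (All _) (trans (take-take k r d) (cong (λ i → take i d) (m≤n⇒m⊓n≡m k≤r))) (All.take⁺ k h)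

All-drop-≤ : ∀ {P : ℕ → Set} {k r} d → k ≤ r → All P (drop k d) → All P (drop r d)
All-drop-≤ {k = k} {r} d k≤r h =
  subst (All _) (trans (drop-drop k (r ∸ k) d) (cong (λ i → drop i d) (m+[n∸m]≡n k≤r))) (All.drop⁺ (r ∸ k) h)

take-drop-overlap : ∀ {P Q : ℕ → Set} {k l} d → k < l → k < length d →
  All P (take l d) → All Q (drop k d) → ∃ λ x → P x × Q x
take-drop-overlap {k = zero} {suc l} (x ∷ d) _ _ (p ∷ _) (q ∷ _) = x , p , q
take-drop-overlap {k = suc k} {suc l} (x ∷ d) k<l k<len (_ ∷ ps) qs = take-drop-overlap d (s≤s⁻¹ k<l) (s≤s⁻¹ k<len) ps qs

drop-∷ : ∀ {A : Set} l (d : List A) → l < length d → ∃ λ y → ∃ λ ys → drop l d ≡ y ∷ ys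
drop-∷ zero (x ∷ d) _ = x , d , refl
drop-∷ (suc l) (x ∷ d) l<len = drop-∷ l d (s≤s⁻¹ l<len)

-- Nonincreasing sequences and m(d)

Nonincreasing : List ℕ → Set
Nonincreasing = AllPairs (λ x y → y ≤ x)

insertDesc-↭ : ∀ x ys → insertDesc x ys ↭ x ∷ ys
insertDesc-↭ x [] = ↭-refl
insertDesc-↭ x (y ∷ ys) with y ≤ᵇ x
... | true = ↭-refl
... | false = ↭-trans (prep y (insertDesc-↭ x ys)) (swap y x ↭-refl)

insertDesc-nonincreasing : ∀ x {ys} → Nonincreasing ys → Nonincreasing (insertDesc x ys)
insertDesc-nonincreasing x [] = [] ∷ []
insertDesc-nonincreasing x {y ∷ ys} (y≥ys ∷ ys↓) with y ≤ᵇ x | ≤ᵇ-reflects-≤ y x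
... | true | ofʸ y≤x = (y≤x ∷ All.map (λ z≤y → ≤-trans z≤y y≤x) y≥ys) ∷ y≥ys ∷ ys↓
... | false | ofⁿ y≰x = x≤y∷y≥ys ∷ insertDesc-nonincreasing x ys↓
  where
  x≤y∷y≥ys : All (_≤ y) (insertDesc x ys)
  x≤y∷y≥ys = ↭.All-resp-↭ (↭-sym (insertDesc-↭ x ys)) (<⇒≤ (≰⇒> y≰x) ∷ y≥ys)

sortDesc-↭ : ∀ xs → sortDesc xs ↭ xs
sortDesc-↭ [] = ↭-refl
sortDesc-↭ (x ∷ xs) = ↭-trans (insertDesc-↭ x (sortDesc xs)) (prep x (sortDesc-↭ xs))

sortDesc-nonincreasing : ∀ xs → Nonincreasing (sortDesc xs)
sortDesc-nonincreasing [] = []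
sortDesc-nonincreasing (x ∷ xs) = insertDesc-nonincreasing x (sortDesc-nonincreasing xs)

nonincreasing-↭⇒≡ : ∀ {xs ys} → Nonincreasing xs → Nonincreasing ys → xs ↭ ys → xs ≡ ys
nonincreasing-↭⇒≡ xs↓ ys↓ p = Pointwise-≡⇒≡ (Sorted.↗↭↗⇒≋ ≥-totalOrder (sorted xs↓) (sorted ys↓) (↭⇒↭ₛ p))
  where
  ≥-totalOrder = Flip.totalOrder ≤-totalOrder
  sorted = Sorted.AllPairs⇒Sorted ≥-totalOrder

take≥drop : ∀ {d} l → Nonincreasing d → All (λ x → All (_≤ x) (drop l d)) (take l d)
take≥drop zero _ = []
take≥drop {[]} (suc l) _ = []
take≥drop {x ∷ d} (suc l) (x≥d ∷ d↓) = All.drop⁺ l x≥d ∷ take≥drop l d↓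

reverse-nonincreasing : ∀ {xs} → AllPairs _≤_ xs → Nonincreasing (reverse xs)
reverse-nonincreasing [] = []
reverse-nonincreasing {x ∷ xs} (x≤xs ∷ xs↑) = subst Nonincreasing (sym (reverse-++ (x ∷ []) xs))
  (AllPairs.++⁺ (reverse-nonincreasing xs↑) ([] ∷ []) (All.map (_∷ []) (↭.All-resp-↭ (↭-sym (↭.↭-reverse xs)) x≤xs)))

-- The loop behind m is private to Defs. Generalising 1 and 0 lets unification solve scan as
-- that loop, so that m d and scan 1 d 0 are definitionally equal.
mutual
  scan : ℕ → List ℕ → ℕ → ℕ
  scan = _

  m≡scan : ∀ d → m d ≡ scan 1 d 0
  m≡scan with 1 | 0
  ... | i | acc = λ d → refl {x = scan i d acc}

scan-stops : ∀ j {xs} acc → All (_< j) xs → scan (suc j) xs acc ≡ acc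
scan-stops j acc [] = refl
scan-stops j {x ∷ xs} acc (x<j ∷ xs<j) with j ≤ᵇ x | ≤ᵇ-reflects-≤ j x
... | true | ofʸ j≤x = ⊥-elim (<⇒≱ x<j j≤x)
... | false | _ = scan-stops (suc j) acc (All.map (λ y<j → ≤-trans y<j (n≤1+n j)) xs<j)

record CorrectedDurfee (r : ℕ) (d : List ℕ) : Set where
  field
    ≤length : r ≤ length d
    front   : All (λ x → r ≤ suc x) (take r d)
    back    : All (_< r) (drop r d)

scan-split : ∀ j xs → Nonincreasing xs → let r = scan (suc j) xs j in
  ∃ λ t → r ≡ j + t × t ≤ length xs × All (λ x → r ≤ suc x) (take t xs) × All (_< r) (drop t xs)
scan-split j [] [] = 0 , sym (+-identityʳ j) , z≤n , [] , []
scan-split j (x ∷ xs) (x≥xs ∷ xs↓) with j ≤ᵇ x | ≤ᵇ-reflects-≤ j x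
... | false | ofⁿ j≰x =
  0 , trans r≡j (sym (+-identityʳ j)) , z≤n , [] , x<r ∷ All.map (λ y≤x → <-≤-trans (s≤s y≤x) x<r) x≥xs
  where
  x<j = ≰⇒> j≰x
  r≡j : scan (suc (suc j)) xs j ≡ j
  r≡j = scan-stops (suc j) j (All.map (λ y≤x → ≤-trans (s≤s y≤x) (≤-trans x<j (n≤1+n j))) x≥xs)
  x<r : x < scan (suc (suc j)) xs j
  x<r = ≤-trans x<j (≤-reflexive (sym r≡j))
... | true | ofʸ j≤x with scan-split (suc j) xs xs↓
...   | t , r≡ , t≤ , front , back =
  suc t , trans r≡ (sym (+-suc j t)) , s≤s t≤ , r≤sx t x≥xs t≤ r≡ front ∷ front , back
  where
  r≤sx : ∀ {r} t {xs} → All (_≤ x) xs → t ≤ length xs → r ≡ suc j + t →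
    All (λ y → r ≤ suc y) (take t xs) → r ≤ suc x
  r≤sx zero _ _ r≡ _ = ≤-trans (≤-reflexive (trans r≡ (+-identityʳ (suc j)))) (s≤s j≤x)
  r≤sx (suc t) (y≤x ∷ _) _ _ (r≤sy ∷ _) = ≤-trans r≤sy (s≤s y≤x)

m-corrected-Durfee : ∀ {d} → Nonincreasing d → CorrectedDurfee (m d) d
m-corrected-Durfee {d} d↓ with scan-split 0 d d↓
... | t , r≡t , t≤ , front , back rewrite r≡t = record { ≤length = t≤ ; front = front ; back = back }

m≡0⇒[] : ∀ {d} → Nonincreasing d → m d ≡ 0 → d ≡ []
m≡0⇒[] {[]} _ _ = refl
m≡0⇒[] {x ∷ d} d↓ m≡0 with subst (λ r → All (_< r) (drop r (x ∷ d))) m≡0 (CorrectedDurfee.back (m-corrected-Durfee d↓))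
... | () ∷ _

-- The variant Δ′ of Δ

Δ′⁺ Δ′⁻ : ℕ → List ℕ → ℕ
Δ′⁺ k d = ∑ (_⊓ k) (drop k d)
Δ′⁻ k d = ∑ (λ x → suc x ∸ k) (take k d)

-- The term k(k−1) of Δ_k is absorbed into the first k entries, d_i becoming (d_i + 1 − k)⁺.
Δ′ : ℕ → List ℕ → ℤ
Δ′ k d = ℤ.+ Δ′⁺ k d ℤ.- ℤ.+ Δ′⁻ k d

k*[k∸1]+∑[1+x∸k]≡sum : ∀ k {A} → length A ≡ k → All (λ x → k ≤ suc x) A → k * (k ∸ 1) + ∑ (λ x → suc x ∸ k) A ≡ sum A
k*[k∸1]+∑[1+x∸k]≡sum zero {[]} _ [] = refl
k*[k∸1]+∑[1+x∸k]≡sum (suc k) {A} len front =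
  trans (cong (λ l → l * k + ∑ (_∸ k) A) (sym len)) (∑-∸-const k (All.map s≤s⁻¹ front))

Δ≡Δ′ : ∀ k d → k ≤ length d → All (λ x → k ≤ suc x) (take k d) → Δ k d ≡ Δ′ k d
Δ≡Δ′ k d k≤len front = diff-≡-cross _ (sum (take k d)) _ (Δ′⁻ k d) (begin
  k * (k ∸ 1) + Δ′⁺ k d + Δ′⁻ k d   ≡⟨ shuffle (k * (k ∸ 1)) (Δ′⁺ k d) (Δ′⁻ k d) ⟩
  Δ′⁺ k d + (k * (k ∸ 1) + Δ′⁻ k d) ≡⟨ cong (Δ′⁺ k d +_) (k*[k∸1]+∑[1+x∸k]≡sum k (length-take-≤ k d k≤len) front) ⟩
  Δ′⁺ k d + sum (take k d)          ∎)
  where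
  open ≡-Reasoning
  shuffle : ∀ a b c → a + b + c ≡ b + (a + c)
  shuffle = solve-∀

module Pieces (k a : ℕ) (d : List ℕ) (k+a≤len : k + a ≤ length d) where
  front middle rest : List ℕ
  front = take k d
  middle = take a (drop k d)
  rest = drop (k + a) d

  take≡front++middle : take (k + a) d ≡ front ++ middle
  take≡front++middle = take-+ k a d

  drop≡middle++rest : drop k d ≡ middle ++ rest
  drop≡middle++rest = drop≡take++drop-+ k a d

  ∑-take : ∀ g → ∑ g (take (k + a) d) ≡ ∑ g front + ∑ g middle
  ∑-take g = trans (cong (∑ g) take≡front++middle) (∑-++ g front middle)

  ∑-drop : ∀ g → ∑ g (drop k d) ≡ ∑ g middle + ∑ g rest
  ∑-drop g = trans (cong (∑ g) drop≡middle++rest) (∑-++ g middle rest)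

  ∑-front-const : ∀ c → ∑ (λ _ → c) front ≡ k * c
  ∑-front-const c = trans (∑-constant c front) (cong (_* c) (length-take-≤ k d (m+n≤o⇒m≤o k k+a≤len)))

  ∑-middle-const : ∀ c → ∑ (λ _ → c) middle ≡ a * c
  ∑-middle-const c = trans (∑-constant c middle) (cong (_* c) (length-take-≤ a (drop k d) (begin
    a                 ≡⟨ m+n∸m≡n k a ⟨
    (k + a) ∸ k       ≤⟨ ∸-monoˡ-≤ k k+a≤len ⟩
    length d ∸ k      ≡⟨ length-drop k d ⟨
    length (drop k d) ∎)))
    where open ≤-Reasoning

Δ′-≤-downward : ∀ k l d → k ≤ l → l ≤ length d →
  All (k ≤_) (take l d) → All (_≤ k) (drop l d) → Δ′ l d ℤ.≤ Δ′ k d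
Δ′-≤-downward k l d k≤l l≤len take≥k drop≤k with m≤n⇒∃[o]m+o≡n k≤l
... | a , refl = diff-≤-cross (Δ′⁺ l d) (Δ′⁻ l d) (Δ′⁺ k d) (Δ′⁻ k d) (begin
  Δ′⁺ l d + Δ′⁻ k d                                            ≡⟨ cong (_+ Δ′⁻ k d) rest-⊓ ⟩
  ∑ (_⊓ k) rest + Δ′⁻ k d                                      ≤⟨ +-monoʳ-≤ (∑ (_⊓ k) rest) front-∸ ⟩
  ∑ (_⊓ k) rest + (k * a + ∑ excess front)                     ≤⟨ rearrange (∑ (_⊓ k) rest) (∑ excess front) (∑ excess middle) ⟩
  (a * k + ∑ (_⊓ k) rest) + (∑ excess front + ∑ excess middle) ≡⟨ cong₂ _+_ Δ′⁺-k (∑-take excess) ⟨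
  Δ′⁺ k d + Δ′⁻ l d                                            ∎)
  where
  open Pieces k a d l≤len
  open ≤-Reasoning
  excess : ℕ → ℕ
  excess x = suc x ∸ l
  rest-⊓ : ∑ (_⊓ l) rest ≡ ∑ (_⊓ k) rest
  rest-⊓ = ∑-cong (All.map (λ x≤k → trans (m≤n⇒m⊓n≡m (≤-trans x≤k k≤l)) (sym (m≤n⇒m⊓n≡m x≤k))) drop≤k)
  split-∸ : ∀ y → y ∸ k ≤ a + (y ∸ l)
  split-∸ y = ≤-trans (m≤n+m∸n (y ∸ k) a) (≤-reflexive (cong (a +_) (∸-+-assoc y k a)))
  front-∸ : Δ′⁻ k d ≤ k * a + ∑ excess front
  front-∸ = begin
    ∑ (λ x → suc x ∸ k) front          ≤⟨ ∑-mono-≤ (All.universal (λ x → split-∸ (suc x)) front) ⟩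
    ∑ (λ x → a + excess x) front       ≡⟨ ∑-+ (λ _ → a) excess front ⟩
    ∑ (λ _ → a) front + ∑ excess front ≡⟨ cong (_+ ∑ excess front) (∑-front-const a) ⟩
    k * a + ∑ excess front             ∎
  rearrange : ∀ X Y Z → X + (k * a + Y) ≤ (a * k + X) + (Y + Z)
  rearrange X Y Z = ≤-trans (≤-reflexive (shuffle X Y k a)) (+-monoʳ-≤ (a * k + X) (m≤m+n Y Z))
    where
    shuffle : ∀ X Y k a → X + (k * a + Y) ≡ (a * k + X) + Y
    shuffle = solve-∀
  middle-⊓ : All (λ x → x ⊓ k ≡ k) middle
  middle-⊓ = All.map m≥n⇒m⊓n≡n (All.++⁻ʳ front (subst (All (k ≤_)) take≡front++middle take≥k))
  Δ′⁺-k : Δ′⁺ k d ≡ a * k + ∑ (_⊓ k) rest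
  Δ′⁺-k = trans (∑-drop (_⊓ k)) (cong (_+ ∑ (_⊓ k) rest) (trans (∑-cong middle-⊓) (∑-middle-const k)))

Δ′-≤-upward : ∀ l k d → l ≤ k → k ≤ length d →
  All (λ x → k ≤ suc x) (take l d) → All (_< k) (drop l d) → Δ′ l d ℤ.≤ Δ′ k d
Δ′-≤-upward l k d l≤k k≤len take≥k-1 drop<k with m≤n⇒∃[o]m+o≡n l≤k
... | b , refl = diff-≤-cross (Δ′⁺ l d) (Δ′⁻ l d) (Δ′⁺ k d) (Δ′⁻ k d) (begin
  Δ′⁺ l d + Δ′⁻ k d                                   ≡⟨ cong₂ _+_ (∑-drop (_⊓ l)) Δ′⁻-k ⟩
  (∑ (_⊓ l) middle + ∑ (_⊓ l) rest) + ∑ excess front   ≤⟨ +-monoˡ-≤ (∑ excess front) (+-mono-≤ middle-⊓ rest-⊓) ⟩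
  (b * l + ∑ (_⊓ k) rest) + ∑ excess front             ≡⟨ shuffle b l (∑ (_⊓ k) rest) (∑ excess front) ⟩
  ∑ (_⊓ k) rest + (∑ excess front + l * b)             ≡⟨ cong (∑ (_⊓ k) rest +_) Δ′⁻-l ⟨
  Δ′⁺ k d + Δ′⁻ l d                                   ∎)
  where
  open Pieces l b d k≤len
  open ≤-Reasoning
  excess : ℕ → ℕ
  excess x = suc x ∸ k
  shuffle : ∀ b l X Y → (b * l + X) + Y ≡ X + (Y + l * b)
  shuffle = solve-∀
  middle<k : All (_< k) middle
  middle<k = All.++⁻ˡ middle (subst (All (_< k)) drop≡middle++rest drop<k)
  Δ′⁻-k : Δ′⁻ k d ≡ ∑ excess front
  Δ′⁻-k = trans (∑-take excess)
    (trans (cong (∑ excess front +_) (∑-zero (All.map m≤n⇒m∸n≡0 middle<k))) (+-identityʳ _))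
  middle-⊓ : ∑ (_⊓ l) middle ≤ b * l
  middle-⊓ = ≤-trans (∑-mono-≤ (All.universal (λ x → m⊓n≤n x l) middle)) (≤-reflexive (∑-middle-const l))
  rest-⊓ : ∑ (_⊓ l) rest ≤ ∑ (_⊓ k) rest
  rest-⊓ = ∑-mono-≤ (All.universal (λ x → ⊓-monoʳ-≤ x (m≤m+n l b)) rest)
  shift : ∀ {y} → l + b ≤ y → y ∸ l ≡ y ∸ (l + b) + b
  shift {y} l+b≤y = begin-equality
    y ∸ l             ≡⟨ m∸n+n≡m (≤-trans (≤-reflexive (sym (m+n∸m≡n l b))) (∸-monoˡ-≤ l l+b≤y)) ⟨
    (y ∸ l) ∸ b + b   ≡⟨ cong (_+ b) (∸-+-assoc y l b) ⟩
    y ∸ (l + b) + b   ∎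
  Δ′⁻-l : Δ′⁻ l d ≡ ∑ excess front + l * b
  Δ′⁻-l = begin-equality
    ∑ (λ x → suc x ∸ l) front          ≡⟨ ∑-cong (All.map shift take≥k-1) ⟩
    ∑ (λ x → excess x + b) front       ≡⟨ ∑-+ excess (λ _ → b) front ⟩
    ∑ excess front + ∑ (λ _ → b) front ≡⟨ cong (∑ excess front +_) (∑-front-const b) ⟩
    ∑ excess front + l * b             ∎

Δ′-zero : ∀ d → Δ′ 0 d ≡ ℤ.+ 0
Δ′-zero d = cong (λ s → ℤ.+ s ℤ.- ℤ.+ 0) (∑-zero (All.universal ⊓-zeroʳ d))

-- Complementary sequences

complementSeq : ℕ → List ℕ → List ℕ
complementSeq n d = reverse (map ((n ∸ 1) ∸_) d)

complementSeq-↭ : ∀ n d → complementSeq n d ↭ map ((n ∸ 1) ∸_) d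
complementSeq-↭ n d = ↭.↭-reverse (map ((n ∸ 1) ∸_) d)

length-complementSeq : ∀ n d → length (complementSeq n d) ≡ length d
length-complementSeq n d = trans (↭.↭-length (complementSeq-↭ n d)) (length-map ((n ∸ 1) ∸_) d)

complementSeq-++ : ∀ n A B → complementSeq n (A ++ B) ≡ complementSeq n B ++ complementSeq n A
complementSeq-++ n A B = trans (cong reverse (map-++ ((n ∸ 1) ∸_) A B)) (reverse-++ (map _ A) (map _ B))

∑-complementSeq : ∀ g n A → ∑ g (complementSeq n A) ≡ ∑ (λ x → g ((n ∸ 1) ∸ x)) A
∑-complementSeq g n A = trans (∑-↭ g (complementSeq-↭ n A)) (cong sum (sym (map-∘ A)))

All-complementSeq⁺ : ∀ {P : ℕ → Set} n {d} → All (λ x → P ((n ∸ 1) ∸ x)) d → All P (complementSeq n d)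
All-complementSeq⁺ n {d} h = ↭.All-resp-↭ (↭-sym (complementSeq-↭ n d)) (All.map⁺ h)

All-complementSeq⁻ : ∀ {P : ℕ → Set} n {d} → All P (complementSeq n d) → All (λ x → P ((n ∸ 1) ∸ x)) d
All-complementSeq⁻ n {d} h = All.map⁻ (↭.All-resp-↭ (complementSeq-↭ n d) h)

complementSeq-bounded : ∀ n d → All (_≤ n ∸ 1) (complementSeq n d)
complementSeq-bounded n d = All-complementSeq⁺ n (All.universal (m∸n≤m (n ∸ 1)) d)

complementSeq-involutive : ∀ n {d} → All (_≤ n ∸ 1) d → complementSeq n (complementSeq n d) ≡ d
complementSeq-involutive n {d} d≤ = begin
  reverse (map f (reverse (map f d))) ≡⟨ cong reverse (reverse-map f (map f d)) ⟩
  reverse (reverse (map f (map f d))) ≡⟨ reverse-involutive (map f (map f d)) ⟩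
  map f (map f d)                     ≡⟨ map-∘ d ⟨
  map (λ x → f (f x)) d               ≡⟨ map-cong-local (All.map m∸[m∸n]≡n d≤) ⟩
  map (λ x → x) d                     ≡⟨ map-id d ⟩
  d                                   ∎
  where
  open ≡-Reasoning
  f = (n ∸ 1) ∸_

complementSeq-nonincreasing : ∀ n {d} → Nonincreasing d → Nonincreasing (complementSeq n d)
complementSeq-nonincreasing n d↓ = reverse-nonincreasing (AllPairs.map⁺ (AllPairs.map (∸-monoʳ-≤ (n ∸ 1)) d↓))

complementSeq-take-drop : ∀ n d l k → l + k ≡ length d →
  take k (complementSeq n d) ≡ complementSeq n (drop l d) × drop k (complementSeq n d) ≡ complementSeq n (take l d)
complementSeq-take-drop n d l k l+k≡len =
  trans (cong (take k) d̄≡) (take-length-++ (complementSeq n (drop l d)) (complementSeq n (take l d)) len) ,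
  trans (cong (drop k) d̄≡) (drop-length-++ (complementSeq n (drop l d)) (complementSeq n (take l d)) len)
  where
  d̄≡ : complementSeq n d ≡ complementSeq n (drop l d) ++ complementSeq n (take l d)
  d̄≡ = trans (cong (complementSeq n) (sym (take++drop≡id l d))) (complementSeq-++ n (take l d) (drop l d))
  len : length (complementSeq n (drop l d)) ≡ k
  len = trans (length-complementSeq n (drop l d)) (trans (length-drop l d) (trans (cong (_∸ l) (sym l+k≡len)) (m+n∸m≡n l k)))

∑-front-identity : ∀ {n} l k A → l + k ≡ n → length A ≡ l → All (_≤ n ∸ 1) A →
  ∑ (λ x → (n ∸ 1 ∸ x) ⊓ k) A + ∑ (λ x → suc x ∸ l) A ≡ l * k
∑-front-identity zero k [] _ _ _ = refl
∑-front-identity (suc l) k A refl len A≤ = begin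
  ∑ (λ x → (l + k ∸ x) ⊓ k) A + ∑ (_∸ l) A ≡⟨ ∑-+ (λ x → (l + k ∸ x) ⊓ k) (_∸ l) A ⟨
  ∑ (λ x → (l + k ∸ x) ⊓ k + (x ∸ l)) A    ≡⟨ ∑-const (All.map ([m+n∸o]⊓n+[o∸m]≡n l k _) A≤) ⟩
  length A * k                             ≡⟨ cong (_* k) len ⟩
  suc l * k                                ∎
  where open ≡-Reasoning

∑-back-identity : ∀ {n} l k B → l + k ≡ n → length B ≡ k → All (_≤ n ∸ 1) B →
  ∑ (_⊓ l) B + ∑ (λ x → suc (n ∸ 1 ∸ x) ∸ k) B ≡ k * l
∑-back-identity l zero [] _ _ _ = refl
∑-back-identity l (suc k) B refl len B≤ rewrite +-suc l k = begin
  ∑ (_⊓ l) B + ∑ (λ x → l + k ∸ x ∸ k) B ≡⟨ ∑-+ (_⊓ l) (λ x → l + k ∸ x ∸ k) B ⟨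
  ∑ (λ x → x ⊓ l + (l + k ∸ x ∸ k)) B    ≡⟨ ∑-const (All.map (o⊓m+[m+n∸o∸n]≡m l k _) B≤) ⟩
  length B * l                           ≡⟨ cong (_* l) len ⟩
  suc k * l                              ∎
  where open ≡-Reasoning

Δ′-complementSeq : ∀ {n k} d → length d ≡ n → k ≤ n → All (_≤ n ∸ 1) d →
  Δ′ k (complementSeq n d) ≡ Δ′ (n ∸ k) d
Δ′-complementSeq {n} {k} d len k≤n d≤ = diff-≡-cross (Δ′⁺ k d̄) (Δ′⁻ k d̄) (Δ′⁺ l d) (Δ′⁻ l d) (begin
  Δ′⁺ k d̄ + Δ′⁻ l d                                             ≡⟨ cong (_+ Δ′⁻ l d) Δ′⁺-d̄ ⟩
  ∑ (λ x → f x ⊓ k) (take l d) + ∑ (λ x → suc x ∸ l) (take l d) ≡⟨ ∑-front-identity l k _ l+k≡n len-take (All.take⁺ l d≤) ⟩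
  l * k                                                         ≡⟨ *-comm l k ⟩
  k * l                                                         ≡⟨ ∑-back-identity l k _ l+k≡n len-drop (All.drop⁺ l d≤) ⟨
  ∑ (_⊓ l) (drop l d) + ∑ (λ x → suc (f x) ∸ k) (drop l d)      ≡⟨ cong (Δ′⁺ l d +_) Δ′⁻-d̄ ⟨
  Δ′⁺ l d + Δ′⁻ k d̄                                             ∎)
  where
  open ≡-Reasoning
  l = n ∸ k
  f = (n ∸ 1) ∸_
  d̄ = complementSeq n d
  l+k≡n : l + k ≡ n
  l+k≡n = m∸n+n≡m k≤n
  len-take : length (take l d) ≡ l
  len-take = length-take-≤ l d (≤-trans (m∸n≤m n k) (≤-reflexive (sym len)))
  len-drop : length (drop l d) ≡ k
  len-drop = trans (length-drop l d) (trans (cong (_∸ l) len) (m∸[m∸n]≡n k≤n))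
  pieces = complementSeq-take-drop n d l k (trans l+k≡n (sym len))
  Δ′⁺-d̄ : Δ′⁺ k d̄ ≡ ∑ (λ x → f x ⊓ k) (take l d)
  Δ′⁺-d̄ = trans (cong (∑ (_⊓ k)) (proj₂ pieces)) (∑-complementSeq (_⊓ k) n (take l d))
  Δ′⁻-d̄ : Δ′⁻ k d̄ ≡ ∑ (λ x → suc (f x) ∸ k) (drop l d)
  Δ′⁻-d̄ = trans (cong (∑ (λ y → suc y ∸ k)) (proj₁ pieces)) (∑-complementSeq (λ y → suc y ∸ k) n (drop l d))

-- Δ, Δ* and complementation

ΔBound : ℤ → List ℕ → Set
ΔBound X d = ∀ k → 1 ≤ k → k ≤ m d → Δ k d ℤ.≤ X

module _ {d : List ℕ} (d↓ : Nonincreasing d) where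
  open CorrectedDurfee (m-corrected-Durfee d↓)

  Δ≡Δ′-below-m : ∀ k → k ≤ m d → Δ k d ≡ Δ′ k d
  Δ≡Δ′-below-m k k≤m = Δ≡Δ′ k d (≤-trans k≤m ≤length) (All-take-≤ d k≤m (All.map (≤-trans k≤m) front))

  Δ′-dominated-below-m : ∀ l → l < length d → ∃ λ k → k ≤ m d × Δ′ l d ℤ.≤ Δ′ k d
  Δ′-dominated-below-m l l<len with l ≤? m d
  ... | yes l≤m = l , l≤m , ℤ.≤-refl
  ... | no l≰m with drop-∷ l d l<len
  ...   | y , ys , drop≡y∷ys = y , <⇒≤ y<m , Δ′-≤-downward y l d y≤l (<⇒≤ l<len) take≥y drop≤y
    where
    y<m : y < m d
    y<m with subst (All (_< m d)) drop≡y∷ys (All-drop-≤ d (<⇒≤ (≰⇒> l≰m)) back)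
    ... | y<m ∷ _ = y<m
    y≤l : y ≤ l
    y≤l = ≤-trans (<⇒≤ y<m) (<⇒≤ (≰⇒> l≰m))
    take≥y : All (y ≤_) (take l d)
    take≥y = All.map (λ drop≤x → All.head (subst (All _) drop≡y∷ys drop≤x)) (take≥drop l d↓)
    drop≤y : All (_≤ y) (drop l d)
    drop≤y with subst Nonincreasing drop≡y∷ys (AllPairs.drop⁺ l d↓)
    ... | y≥ys ∷ _ = subst (All (_≤ y)) (sym drop≡y∷ys) (≤-refl ∷ y≥ys)

  -- Here m(d) is l or l + 1, and in the second case the two monotonicity lemmas squeeze.
  Δ′-≡-at-balanced-point : ∀ l → l ≤ length d → All (l ≤_) (take l d) → All (_≤ l) (drop l d) →
    Δ′ l d ≡ Δ′ (m d) d
  Δ′-≡-at-balanced-point l l≤len take≥l drop≤l with <-cmp l (m d)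
  ... | tri≈ _ l≡m _ = cong (λ i → Δ′ i d) l≡m
  ... | tri> _ _ m<l with take-drop-overlap d m<l (<-≤-trans m<l l≤len) take≥l back
  ...   | x , l≤x , x<m = ⊥-elim (<-irrefl refl (<-≤-trans m<l (≤-trans l≤x (<⇒≤ x<m))))
  Δ′-≡-at-balanced-point l l≤len take≥l drop≤l | tri< l<m _ _ = ℤ.≤-antisym
    (Δ′-≤-upward l (m d) d (<⇒≤ l<m) ≤length (All.map (λ l≤x → ≤-trans m≤1+l (s≤s l≤x)) take≥l)
      (All.map (λ x≤l → <-≤-trans (s≤s x≤l) l<m) drop≤l))
    (Δ′-≤-downward l (m d) d (<⇒≤ l<m) ≤length (All.map (λ m≤1+x → s≤s⁻¹ (≤-trans l<m m≤1+x)) front)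
      (All.map (λ x<m → s≤s⁻¹ (≤-trans x<m m≤1+l)) back))
    where
    m≤1+l : m d ≤ suc l
    m≤1+l with take-drop-overlap d l<m (<-≤-trans l<m ≤length) front drop≤l
    ... | x , m≤1+x , x≤l = ≤-trans m≤1+x (s≤s x≤l)

-- 0 ≤ X accounts for Δ′_0 = 0, which ΔBound does not cover.
Δ′-bounded : ∀ {d X} → Nonincreasing d → ℤ.+ 0 ℤ.≤ X → ΔBound X d → ∀ l → l < length d → Δ′ l d ℤ.≤ X
Δ′-bounded {d} d↓ X≥0 Δ≤X l l<len with Δ′-dominated-below-m d↓ l l<len
... | zero , _ , Δ′≤ = ℤ.≤-trans Δ′≤ (ℤ.≤-trans (ℤ.≤-reflexive (Δ′-zero d)) X≥0)
... | suc j , j<m , Δ′≤ =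
  ℤ.≤-trans Δ′≤ (ℤ.≤-trans (ℤ.≤-reflexive (sym (Δ≡Δ′-below-m d↓ (suc j) j<m))) (Δ≤X (suc j) (s≤s z≤n) j<m))

record Admissible (n : ℕ) (d : List ℕ) : Set where
  field
    nonincreasing : Nonincreasing d
    bounded       : All (_≤ n ∸ 1) d
    length≡       : length d ≡ n

complementSeq-admissible : ∀ {n d} → Admissible n d → Admissible n (complementSeq n d)
complementSeq-admissible {n} {d} a = record
  { nonincreasing = complementSeq-nonincreasing n nonincreasing
  ; bounded       = complementSeq-bounded n d
  ; length≡       = trans (length-complementSeq n d) length≡
  }
  where open Admissible a

module _ {n d} (a : Admissible n d) where
  open Admissible a
  private
    d̄ = complementSeq n d
    ā = complementSeq-admissible a
    module d̄ = Admissible ā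

  m-complementSeq≤n : m d̄ ≤ n
  m-complementSeq≤n = ≤-trans (CorrectedDurfee.≤length (m-corrected-Durfee d̄.nonincreasing)) (≤-reflexive d̄.length≡)

  Δ-complementSeq≡Δ′ : ∀ k → k ≤ m d̄ → Δ k d̄ ≡ Δ′ (n ∸ k) d
  Δ-complementSeq≡Δ′ k k≤m̄ =
    trans (Δ≡Δ′-below-m d̄.nonincreasing k k≤m̄) (Δ′-complementSeq d length≡ (≤-trans k≤m̄ m-complementSeq≤n) bounded)

  ΔBound-complementSeq : ∀ {X} → ℤ.+ 0 ℤ.≤ X → ΔBound X d → ΔBound X d̄
  ΔBound-complementSeq {X} X≥0 Δ≤X k 1≤k k≤m̄ = begin
    Δ k d̄          ≡⟨ Δ-complementSeq≡Δ′ k k≤m̄ ⟩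
    Δ′ (n ∸ k) d   ≤⟨ Δ′-bounded nonincreasing X≥0 Δ≤X (n ∸ k) n∸k<len ⟩
    X              ∎
    where
    open ℤ.≤-Reasoning
    n∸k<len : n ∸ k < length d
    n∸k<len = ≤-trans (m<m+n (n ∸ k) 1≤k)
      (≤-reflexive (trans (m∸n+n≡m (≤-trans k≤m̄ m-complementSeq≤n)) (sym length≡)))

  -- l̄ = n − m(d̄) is balanced in d because d̄_i ≥ m(d̄) − 1 for i ≤ m(d̄) and d̄_i < m(d̄) for i > m(d̄).
  Δ-m-complementSeq : Δ (m d̄) d̄ ≡ Δ (m d) d
  Δ-m-complementSeq = begin
    Δ m̄ d̄       ≡⟨ Δ-complementSeq≡Δ′ m̄ ≤-refl ⟩
    Δ′ l̄ d      ≡⟨ Δ′-≡-at-balanced-point nonincreasing l̄ l̄≤len take≥l̄ drop≤l̄ ⟩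
    Δ′ (m d) d  ≡⟨ Δ≡Δ′-below-m nonincreasing (m d) ≤-refl ⟨
    Δ (m d) d   ∎
    where
    open ≡-Reasoning
    open CorrectedDurfee (m-corrected-Durfee d̄.nonincreasing)
    m̄ = m d̄
    l̄ = n ∸ m̄
    l̄≤len : l̄ ≤ length d
    l̄≤len = ≤-trans (m∸n≤m n m̄) (≤-reflexive (sym length≡))
    pieces = complementSeq-take-drop n d l̄ m̄ (trans (m∸n+n≡m m-complementSeq≤n) (sym length≡))
    take≥l̄ : All (l̄ ≤_) (take l̄ d)
    take≥l̄ = All.zipWith (λ (x≤ , <m̄) → complement-≤ n m̄ _ x≤ <m̄)
      (All.take⁺ l̄ bounded , All-complementSeq⁻ n (subst (All (_< m̄)) (proj₂ pieces) back))
    drop≤l̄ : All (_≤ l̄) (drop l̄ d)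
    drop≤l̄ = All.zipWith (λ (x≤ , m̄≤) → ≤-complement n m̄ _ x≤ m̄≤)
      (All.drop⁺ l̄ bounded , All-complementSeq⁻ n (subst (All (λ y → m̄ ≤ suc y)) (proj₁ pieces) front))

oneTo⁺ : ∀ {P : ℕ → Set} r → (∀ k → 1 ≤ k → k ≤ r → P k) → All P (oneTo r)
oneTo⁺ zero _ = []
oneTo⁺ (suc r) h =
  All.++⁺ (oneTo⁺ r (λ k 1≤k k≤r → h k 1≤k (≤-trans k≤r (n≤1+n r)))) (h (suc r) (s≤s z≤n) ≤-refl ∷ [])

oneTo⁻ : ∀ {P : ℕ → Set} r → All P (oneTo r) → ∀ k → 1 ≤ k → k ≤ r → P k
oneTo⁻ zero _ (suc k) _ ()
oneTo⁻ (suc r) h k 1≤k k≤1+r with All.++⁻ (oneTo r) h | k ≟ suc r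
... | _ , (p ∷ []) | yes refl = p
... | ps , _ | no k≢1+r = oneTo⁻ r ps k 1≤k (s≤s⁻¹ (≤∧≢⇒< k≤1+r k≢1+r))

module _ (d : List ℕ) where
  private
    fold : List ℕ → ℤ
    fold = foldr (λ k acc → Δ k d ℤ.⊔ acc) (Δ 1 d)

    fold-lub : ∀ {X} ks → Δ 1 d ℤ.≤ X → All (λ k → Δ k d ℤ.≤ X) ks → fold ks ℤ.≤ X
    fold-lub [] Δ₁≤X [] = Δ₁≤X
    fold-lub (k ∷ ks) Δ₁≤X (Δₖ≤X ∷ h) = ℤ.⊔-lub Δₖ≤X (fold-lub ks Δ₁≤X h)

    fold-ub : ∀ ks → Δ 1 d ℤ.≤ fold ks × All (λ k → Δ k d ℤ.≤ fold ks) ks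
    fold-ub [] = ℤ.≤-refl , []
    fold-ub (k ∷ ks) with fold-ub ks
    ... | Δ₁≤ , h = ℤ.≤-trans Δ₁≤ (ℤ.i≤j⊔i (Δ k d) (fold ks)) ,
                   ℤ.i≤i⊔j (Δ k d) (fold ks) ∷ All.map (λ Δ≤ → ℤ.≤-trans Δ≤ (ℤ.i≤j⊔i (Δ k d) (fold ks))) h

  Δ₁≤Δ* : Δ 1 d ℤ.≤ Δ* d
  Δ₁≤Δ* = proj₁ (fold-ub (oneTo (m d)))

  ΔBound-Δ* : ΔBound (Δ* d) d
  ΔBound-Δ* = oneTo⁻ (m d) (proj₂ (fold-ub (oneTo (m d))))

  Δ*-lub : ∀ {X} → Δ 1 d ℤ.≤ X → ΔBound X d → Δ* d ℤ.≤ X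
  Δ*-lub Δ₁≤X Δ≤X = fold-lub (oneTo (m d)) Δ₁≤X (oneTo⁺ (m d) Δ≤X)

Δ*-complementSeq-≤ : ∀ {n d} → Admissible n d → ℤ.+ 0 ℤ.≤ Δ* d → Δ* (complementSeq n d) ℤ.≤ Δ* d
Δ*-complementSeq-≤ {n} {d} a Δ*≥0 = Δ*-lub d̄ Δ₁≤ (ΔBound-complementSeq a Δ*≥0 (ΔBound-Δ* d))
  where
  d̄ = complementSeq n d
  Δ₁≤ : Δ 1 d̄ ℤ.≤ Δ* d
  Δ₁≤ with m d̄ ≟ 0
  ... | yes m̄≡0 =
    subst (λ e → Δ 1 e ℤ.≤ Δ* d) (sym (m≡0⇒[] (Admissible.nonincreasing (complementSeq-admissible a)) m̄≡0)) Δ*≥0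
  ... | no m̄≢0 = ΔBound-complementSeq a Δ*≥0 (ΔBound-Δ* d) 1 ≤-refl (n≢0⇒n>0 m̄≢0)

-- Graphs

without : ∀ {n} → Fin n → (Fin n → ℕ) → Fin n → ℕ
without i g j = if does (i Fin.≟ j) then 0 else g j

sum-tabulate-split : ∀ {n} (i : Fin n) (g : Fin n → ℕ) → sum (tabulate g) ≡ g i + sum (tabulate (without i g))
sum-tabulate-split Fin.zero g = refl
sum-tabulate-split (Fin.suc i) g = begin
  g₀ + sum (tabulate g₊)                         ≡⟨ cong (g₀ +_) (sum-tabulate-split i g₊) ⟩
  g₀ + (g₊ i + sum (tabulate (without i g₊)))    ≡⟨ +-exchange g₀ (g₊ i) _ ⟩
  g₊ i + (g₀ + sum (tabulate (without i g₊)))    ∎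
  where
  open ≡-Reasoning
  g₀ = g Fin.zero
  g₊ = λ j → g (Fin.suc j)
  +-exchange : ∀ a b c → a + (b + c) ≡ b + (a + c)
  +-exchange = solve-∀

∑-allFin-split : ∀ {n} (i : Fin n) (g : Fin n → ℕ) → ∑ g (allFin n) ≡ g i + ∑ (without i g) (allFin n)
∑-allFin-split i g = trans (cong sum (map-tabulate (λ j → j) g))
  (trans (sum-tabulate-split i g) (cong (g i +_) (cong sum (sym (map-tabulate (λ j → j) (without i g))))))

∑-allFin-without : ∀ {n} (i : Fin n) → ∑ (without i (λ _ → 1)) (allFin n) ≡ n ∸ 1
∑-allFin-without {n} i = cong (_∸ 1) (begin
  suc (∑ (without i (λ _ → 1)) (allFin n)) ≡⟨ ∑-allFin-split i (λ _ → 1) ⟨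
  ∑ (λ _ → 1) (allFin n)                  ≡⟨ ∑-constant 1 (allFin n) ⟩
  length (allFin n) * 1                   ≡⟨ *-identityʳ (length (allFin n)) ⟩
  length (allFin n)                       ≡⟨ length-tabulate (λ j → j) ⟩
  n                                       ∎)
  where open ≡-Reasoning

indicator : Bool → ℕ
indicator b = if b then 1 else 0

adj-complement : ∀ {n} (G : Graph n) {i j} → i ≢ j → adj (complement G) i j ≡ not (adj G i j)
adj-complement G {i} {j} i≢j with i Fin.≟ j
... | yes i≡j = ⊥-elim (i≢j i≡j)
... | no _ = refl

indicator-adj-complement : ∀ {n} (G : Graph n) i j →
  indicator (adj G i j) + indicator (adj (complement G) i j) ≡ without i (λ _ → 1) j
indicator-adj-complement G i j with i Fin.≟ j
... | yes refl rewrite irrefl G i = refl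
... | no _ with adj G i j
...   | true = refl
...   | false = refl

degree+degree-complement : ∀ {n} (G : Graph n) i → degree G i + degree (complement G) i ≡ n ∸ 1
degree+degree-complement {n} G i = begin
  ∑ (indicator ∘ adj G i) (allFin n) + ∑ (indicator ∘ adj Ḡ i) (allFin n) ≡⟨ ∑-+ (indicator ∘ adj G i) (indicator ∘ adj Ḡ i) (allFin n) ⟨
  ∑ (λ j → indicator (adj G i j) + indicator (adj Ḡ i j)) (allFin n)     ≡⟨ ∑-cong (All.universal (indicator-adj-complement G i) (allFin n)) ⟩
  ∑ (without i (λ _ → 1)) (allFin n)                                     ≡⟨ ∑-allFin-without i ⟩
  n ∸ 1                                                                  ∎
  where
  open ≡-Reasoning
  Ḡ = complement G

degree-complement : ∀ {n} (G : Graph n) i → degree (complement G) i ≡ (n ∸ 1) ∸ degree G i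
degree-complement G i = trans (sym (m+n∸m≡n (degree G i) _)) (cong (_∸ degree G i) (degree+degree-complement G i))

degree≤n∸1 : ∀ {n} (G : Graph n) i → degree G i ≤ n ∸ 1
degree≤n∸1 G i = ≤-trans (m≤m+n _ _) (≤-reflexive (degree+degree-complement G i))

degSeq-admissible : ∀ {n} (G : Graph n) → Admissible n (degSeq G)
degSeq-admissible {n} G = record
  { nonincreasing = sortDesc-nonincreasing degrees
  ; bounded       = ↭.All-resp-↭ (↭-sym (sortDesc-↭ degrees)) (All.map⁺ (All.universal (degree≤n∸1 G) (allFin n)))
  ; length≡       = trans (↭.↭-length (sortDesc-↭ degrees))
                      (trans (length-map (degree G) (allFin n)) (length-tabulate (λ j → j)))
  }
  where degrees = map (degree G) (allFin n)

degSeq-complement : ∀ {n} (G : Graph n) → degSeq (complement G) ≡ complementSeq n (degSeq G)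
degSeq-complement {n} G = nonincreasing-↭⇒≡
  (Admissible.nonincreasing (degSeq-admissible (complement G)))
  (complementSeq-nonincreasing n (Admissible.nonincreasing (degSeq-admissible G))) (begin
    sortDesc (map (degree (complement G)) (allFin n)) ↭⟨ sortDesc-↭ _ ⟩
    map (degree (complement G)) (allFin n)           ≡⟨ map-cong (degree-complement G) (allFin n) ⟩
    map (λ i → f (degree G i)) (allFin n)            ≡⟨ map-∘ (allFin n) ⟩
    map f (map (degree G) (allFin n))                ↭⟨ ↭.map⁺ f (↭-sym (sortDesc-↭ _)) ⟩
    map f (degSeq G)                                 ↭⟨ complementSeq-↭ n (degSeq G) ⟨
    complementSeq n (degSeq G)                       ∎)
  where
  open PermutationReasoning
  f = (n ∸ 1) ∸_

degree≥1 : ∀ {n} (G : Graph n) {u v} → Adj G u v → 1 ≤ degree G u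
degree≥1 {n} G {u} {v} uv = begin
  1                                                        ≡⟨ cong indicator uv ⟨
  indicator (adj G u v)                                    ≤⟨ m≤m+n _ _ ⟩
  indicator (adj G u v) + ∑ (without v (indicator ∘ adj G u)) (allFin n) ≡⟨ ∑-allFin-split v (indicator ∘ adj G u) ⟨
  degree G u                                               ∎
  where open ≤-Reasoning

indicator-adj≤ : ∀ {n} (G : Graph n) v u → indicator (adj G v u) ≤ without v (λ w → degree G w ⊓ 1) u
indicator-adj≤ G v u with v Fin.≟ u
... | yes refl rewrite irrefl G v = z≤n
... | no _ with adj G v u in vu
...   | true = ⊓-glb (degree≥1 G (trans (Graph.sym G u v) vu)) ≤-refl
...   | false = z≤n

-- Every neighbour of v is a vertex of positive degree other than v.
degree≤∑⊓1-others : ∀ {n} (G : Graph n) v {xs} → degree G v ∷ xs ↭ map (degree G) (allFin n) →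
  degree G v ≤ ∑ (_⊓ 1) xs
degree≤∑⊓1-others {n} G v {xs} p = begin
  degree G v                  ≤⟨ ∑-mono-≤ (All.universal (indicator-adj≤ G v) (allFin n)) ⟩
  ∑ (without v g) (allFin n)  ≡⟨ +-cancelˡ-≡ (g v) _ _ (begin-equality
    g v + ∑ (without v g) (allFin n)     ≡⟨ ∑-allFin-split v g ⟨
    ∑ g (allFin n)                       ≡⟨ cong sum (map-∘ (allFin n)) ⟩
    ∑ (_⊓ 1) (map (degree G) (allFin n)) ≡⟨ ∑-↭ (_⊓ 1) p ⟨
    g v + ∑ (_⊓ 1) xs                    ∎) ⟩
  ∑ (_⊓ 1) xs                 ∎
  where
  open ≤-Reasoning
  g : Fin n → ℕ
  g w = degree G w ⊓ 1

Δ₁-degSeq-nonneg : ∀ {n} (G : Graph n) → ℤ.+ 0 ℤ.≤ Δ 1 (degSeq G)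
Δ₁-degSeq-nonneg {n} G = go (degSeq G) (sortDesc-↭ (map (degree G) (allFin n)))
  where
  go : ∀ d → d ↭ map (degree G) (allFin n) → ℤ.+ 0 ℤ.≤ Δ 1 d
  go [] _ = ℤ.≤-refl
  go (x ∷ xs) p with ∈-map⁻ (degree G) (↭.∈-resp-↭ p (here refl))
  ... | v , _ , refl = diff-≤-cross 0 0 (∑ (_⊓ 1) xs) (degree G v + 0)
    (≤-trans (≤-reflexive (+-identityʳ (degree G v))) (≤-trans (degree≤∑⊓1-others G v p) (m≤m+n _ 0)))

module _ {n} (G : Graph n) where
  private
    d = degSeq G
    a = degSeq-admissible G

  ΔBound-degSeq-complement : ∀ {X} → ℤ.+ 0 ℤ.≤ X → ΔBound X d → ΔBound X (degSeq (complement G))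
  ΔBound-degSeq-complement {X} X≥0 Δ≤X = subst (ΔBound X) (sym (degSeq-complement G)) (ΔBound-complementSeq a X≥0 Δ≤X)

  Δ-m-degSeq-complement : Δ (m (degSeq (complement G))) (degSeq (complement G)) ≡ Δ (m d) d
  Δ-m-degSeq-complement = trans (cong (λ e → Δ (m e) e) (degSeq-complement G)) (Δ-m-complementSeq a)

  Δ*-degSeq-nonneg : ℤ.+ 0 ℤ.≤ Δ* d
  Δ*-degSeq-nonneg = ℤ.≤-trans (Δ₁-degSeq-nonneg G) (Δ₁≤Δ* d)

Δ*-degSeq-complement : ∀ {n} (G : Graph n) → Δ* (degSeq (complement G)) ≡ Δ* (degSeq G)
Δ*-degSeq-complement {n} G = ℤ.≤-antisym
  (subst (λ e → Δ* e ℤ.≤ Δ* (degSeq G)) (sym (degSeq-complement G))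
    (Δ*-complementSeq-≤ (degSeq-admissible G) (Δ*-degSeq-nonneg G)))
  (subst (λ e → Δ* e ℤ.≤ Δ* (degSeq (complement G))) d̄̄≡d
    (Δ*-complementSeq-≤ (degSeq-admissible (complement G)) (Δ*-degSeq-nonneg (complement G))))
  where
  d̄̄≡d : complementSeq n (degSeq (complement G)) ≡ degSeq G
  d̄̄≡d = trans (cong (complementSeq n) (degSeq-complement G))
    (complementSeq-involutive n (Admissible.bounded (degSeq-admissible G)))

¬Adj-refl : ∀ {n} (G : Graph n) i → ¬ Adj G i i
¬Adj-refl G i ii = case trans (sym ii) (irrefl G i) of λ ()

Adj-complement⁺ : ∀ {n} (G : Graph n) {i j} → i ≢ j → ¬ Adj G i j → Adj (complement G) i j
Adj-complement⁺ G i≢j ¬ij = trans (adj-complement G i≢j) (cong not (¬-not ¬ij))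

Adj-complement⁻ : ∀ {n} (G : Graph n) {i j} → i ≢ j → Adj (complement G) i j → ¬ Adj G i j
Adj-complement⁻ G i≢j ij̄ ij = case trans (sym ij̄) (trans (adj-complement G i≢j) (cong not ij)) of λ ()

split-complement : ∀ {n} (G : Graph n) → IsSplit G → IsSplit (complement G)
split-complement G (inC , clique , independent) = (λ i → not (inC i)) , clique′ , independent′
  where
  clique′ : ∀ i j → i ≢ j → not (inC i) ≡ true → not (inC j) ≡ true → Adj (complement G) i j
  clique′ i j i≢j i∉C j∉C = Adj-complement⁺ G i≢j (independent i j (not-injective i∉C) (not-injective j∉C))
  independent′ : ∀ i j → not (inC i) ≡ false → not (inC j) ≡ false → ¬ Adj (complement G) i j
  independent′ i j i∈C j∈C = by-cases (i Fin.≟ j)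
    where
    by-cases : Dec (i ≡ j) → ¬ Adj (complement G) i j
    by-cases (yes refl) = ¬Adj-refl (complement G) i
    by-cases (no i≢j) ij̄ = Adj-complement⁻ G i≢j ij̄ (clique i j i≢j (not-injective i∈C) (not-injective j∈C))

largest-below : ∀ (t : ℚ) xs → ∃ λ s → s ℚ.< t × (∀ {x} → x ∈ xs → x ℚ.< t → x ℚ.≤ s)
largest-below t xs = max (t ℚ.- ℚ.1ℚ) below , argmax-all (λ x → x) t-1<t (All.all-filter (ℚ._<? t) xs) ,
  λ x∈xs x<t → All.lookup (xs≤max (t ℚ.- ℚ.1ℚ) below) (∈-filter⁺ (ℚ._<? t) x∈xs x<t)
  where
  below = filter (ℚ._<? t) xs
  t-1<t : t ℚ.- ℚ.1ℚ ℚ.< t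
  t-1<t = subst (t ℚ.- ℚ.1ℚ ℚ.<_) (ℚ.+-identityʳ t) (ℚ.+-monoʳ-< t (ℚ.*<* ℤ.-<+))

neg-cancel-≤ : ∀ {p q} → ℚ.- p ℚ.≤ ℚ.- q → q ℚ.≤ p
neg-cancel-≤ -p≤-q = ℚ.≮⇒≥ (λ p<q → ℚ.<-irrefl refl (ℚ.≤-<-trans -p≤-q (ℚ.neg-antimono-< p<q)))

-- With weights −w, any threshold −s with s between the largest pair sum below t and t works;
-- such an s exists because there are only finitely many pair sums.
threshold-complement : ∀ {n} (G : Graph n) → IsThreshold G → IsThreshold (complement G)
threshold-complement {n} G (w , t , adj⇔) with largest-below t (cartesianProductWith (λ i j → w i ℚ.+ w j) (allFin n) (allFin n))
... | s , s<t , ≤s = (λ i → ℚ.- w i) , ℚ.- s , λ i j i≢j → mk⇔ (to i j i≢j) (from i j i≢j)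
  where
  -w+-w : ∀ i j → ℚ.- (w i ℚ.+ w j) ≡ ℚ.- w i ℚ.+ ℚ.- w j
  -w+-w i j = ℚ.neg-distrib-+ (w i) (w j)
  to : ∀ i j → i ≢ j → Adj (complement G) i j → ℚ.- s ℚ.≤ ℚ.- w i ℚ.+ ℚ.- w j
  to i j i≢j ij = subst (ℚ.- s ℚ.≤_) (-w+-w i j) (ℚ.neg-antimono-≤ (≤s mem sum<t))
    where
    mem = ∈-cartesianProductWith⁺ (λ i j → w i ℚ.+ w j) (∈-allFin i) (∈-allFin j)
    sum<t : w i ℚ.+ w j ℚ.< t
    sum<t = ℚ.≰⇒> λ t≤sum → Adj-complement⁻ G i≢j ij (Equivalence.from (adj⇔ i j i≢j) t≤sum)
  from : ∀ i j → i ≢ j → ℚ.- s ℚ.≤ ℚ.- w i ℚ.+ ℚ.- w j → Adj (complement G) i j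
  from i j i≢j -s≤ = Adj-complement⁺ G i≢j ¬ij
    where
    sum≤s : w i ℚ.+ w j ℚ.≤ s
    sum≤s = neg-cancel-≤ (subst (ℚ.- s ℚ.≤_) (sym (-w+-w i j)) -s≤)
    ¬ij : ¬ Adj G i j
    ¬ij ij = ℚ.<-irrefl refl (ℚ.≤-<-trans (Equivalence.to (adj⇔ i j i≢j) ij) (ℚ.≤-<-trans sum≤s s<t))

corollary3p10 :
      (∀ {n} (G : Graph n) → IsSplit G → IsSplit (complement G))
    × (∀ {n} (G : Graph n) → IsThreshold G → IsThreshold (complement G))
    × (∀ {n} (G : Graph n) → IsWeaklyThreshold G → IsWeaklyThreshold (complement G))
    × (∀ (I : ℕ → Set) {n} (G : Graph n) → InA I G → InA I (complement G))
    × (∀ (I : ℕ → Set) {n} (G : Graph n) → InB I G → InB I (complement G))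
corollary3p10 =
    split-complement
  , threshold-complement
  , (λ G → ΔBound-degSeq-complement G (ℤ.+≤+ z≤n))
  , (λ I G (k , Δ≡k , k∈I) → k , trans (Δ-m-degSeq-complement G) Δ≡k , k∈I)
  , (λ I G (k , Δ*≡k , k∈I) → k , trans (Δ*-degSeq-complement G) Δ*≡k , k∈I)
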